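{- Let $r$ and $t$ be positive integers and let $G$ be a graph. If $K_t$ is not a depth-$r$ minor of $G$, then the 2VC-dimension of the set system $\mathrm{Balls}_r(G)=\{\{v\in V(G)\colon \mathrm{dist}_G(u,v)\leq r\}\colon u\in V(G)\}$ over the ground set $V(G)$ is at most $t-1$.
   Context: A graph $H$ with vertex set $\{v_1,\ldots,v_n\}$ is a depth-$r$ minor of a graph $G$ if there are connected, pairwise vertex-disjoint subgraphs $H_1,\ldots,H_n\subseteq G$, each of radius at most $r$, such that whenever $v_iv_j\in E(H)$ there are $w_i\in V(H_i)$, $w_j\in V(H_j)$ with $w_iw_j\in E(G)$. $K_t$ denotes the complete graph on $t$ vertices. For a set system $\mathcal{F}$ over a ground set $U$, a set $X\subseteq U$ is 2-shattered by $\mathcal{F}$ if for every $Y\subseteq X$ with $|Y|=2$ there is $F\in\mathcal{F}$ with $F\cap X=Y$; the 2VC-dimension of $\mathcal{F}$ is the maximum size of a set 2-shattered by $\mathcal{F}$. -}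

module Defs where

open import Data.Nat using (ℕ; zero; suc; _≤_; _∸_)
open import Data.Fin using (Fin)
open import Data.Fin.Subset using (Subset; _∈_; _⊆_; ∣_∣)
open import Data.Product using (Σ; ∃; ∃-syntax; _×_; _,_)
open import Relation.Nullary using (¬_)
open import Relation.Binary.PropositionalEquality using (_≡_)
open import Function.Bundles using (_⇔_)

record Graph : Set₁ where
  field
    n     : ℕ
    Adj   : Fin n → Fin n → Set
    sym   : ∀ {u v} → Adj u v → Adj v u
    irrefl : ∀ {u} → ¬ Adj u u

open Graph public

data Walk {A : Set} (R : A → A → Set) : A → A → ℕ → Set where
  nil  : ∀ {x} → Walk R x x zero
  cons : ∀ {x y z k} → R x y → Walk R y z k → Walk R x z (suc k)

DistLe : {A : Set} (R : A → A → Set) → ℕ → A → A → Set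
DistLe R r u v = ∃[ k ] (k ≤ r × Walk R u v k)

record Subgraph (G : Graph) : Set₁ where
  field
    Vert   : Fin (n G) → Set
    Edge   : Fin (n G) → Fin (n G) → Set
    edgeSym : ∀ {u v} → Edge u v → Edge v u
    edge⊆  : ∀ {u v} → Edge u v → Adj G u v × Vert u × Vert v

open Subgraph public

Connected : {G : Graph} → Subgraph G → Set
Connected H = ∀ u v → Vert H u → Vert H v → ∃[ k ] Walk (Edge H) u v k

RadiusLe : {G : Graph} → ℕ → Subgraph G → Set
RadiusLe r H = ∃[ c ] (Vert H c × (∀ v → Vert H v → DistLe (Edge H) r c v))

KtDepthMinor : ℕ → ℕ → Graph → Set₁
KtDepthMinor r t G =
  Σ (Fin t → Subgraph G) λ H →
    (∀ i → Connected (H i)) ×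
    (∀ i → RadiusLe r (H i)) ×
    (∀ i j → ¬ i ≡ j → ∀ v → Vert (H i) v → ¬ Vert (H j) v) ×
    (∀ i j → ¬ i ≡ j →
       ∃[ wi ] ∃[ wj ] (Vert (H i) wi × Vert (H j) wj × Adj G wi wj))

Ball : (G : Graph) → ℕ → Fin (n G) → Fin (n G) → Set
Ball G r u v = DistLe (Adj G) r u v

TwoShattered : (G : Graph) → ℕ → Subset (n G) → Set
TwoShattered G r X =
  ∀ (Y : Subset (n G)) → Y ⊆ X → ∣ Y ∣ ≡ 2 →
    ∃[ u ] (∀ v → ((v ∈ X × Ball G r u v) ⇔ v ∈ Y))

TwoVCDimBallsLe : (G : Graph) → ℕ → ℕ → Set
TwoVCDimBallsLe G r d = ∀ (X : Subset (n G)) → TwoShattered G r X → ∣ X ∣ ≤ d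

module Submission where

-- Proof idea: Voronoi cells.  Let X ⊆ V(G) be 2-shattered by the r-balls
-- of G with |X| ≥ t, and pick t distinct centres in X.  The cell of a
-- centre x consists of the vertices v with dist(v,x) ≤ r at which x is the
-- least centre for the key (dist(v,z), z), ties broken by index.  Cells of
-- distinct centres are disjoint, and a shortest walk from v to its centre
-- stays inside the cell, so each cell is connected of radius ≤ r.  For two
-- centres x ≠ y, shattering {x,y} yields a vertex u whose r-ball meets X
-- exactly in {x,y}.  Every vertex on a walk of length ≤ r from u to x then
-- lies in the cell of x or of y, and u lies in one of the two cells, so some
-- edge of the walk joins them (a discrete intermediate value argument).  The
-- cells therefore form a depth-r minor of K_t.
--   The tie-breaking needs decidable distances, hence decidable adjacency;
-- this holds up to double negation, which suffices because the conclusion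
-- |X| ≤ t - 1 is decidable.

open import Defs
open import Data.Nat using (ℕ; zero; suc; _+_; _∸_; _≤_; _<_; _≤?_; z≤n; s≤s)
open import Data.Nat.Properties
  using (≤-refl; ≤-trans; <⇒≤; n≤1+n; ≤-pred; ≰⇒>; +-suc; +-mono-≤; m≤n+m; m<n⇒m<1+n;
         m<1+n⇒m<n∨m≡n; m+[n∸m]≡n; anyUpTo?)
import Data.Nat.Properties as ℕₚ
open import Data.Fin as Fin using (Fin)
open import Data.Fin.Properties using (any?; ∀-cons; suc-injective; <-asym; <-cmp)
open import Data.Fin.Subset using (Subset; inside; outside; ⁅_⁆; _∪_; _∈_; _⊆_; ∣_∣)
open import Data.Fin.Subset.Properties
  using (∪-identityˡ; ∪-identityʳ; ∣⁅x⁆∣≡1; x∈⁅x⁆; x∈⁅y⁆⇒x≡y; x∈p∪q⁺; x∈p∪q⁻)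
open import Data.Vec using (_∷_; here; there)
open import Data.Product using (∃-syntax; Σ; _×_; _,_; proj₁; proj₂)
open import Data.Sum using (_⊎_; inj₁; inj₂; [_,_]; swap)
import Data.Sum as Sum
open import Data.Empty using (⊥-elim)
open import Function using (_∘_)
open import Function.Bundles using (Equivalence)
open import Function.Definitions using (Injective)
open import Relation.Binary using (tri<; tri≈; tri>)
open import Relation.Binary.PropositionalEquality using (_≡_; refl; trans; cong; subst)
  renaming (sym to ≡-sym)
open import Relation.Nullary using (¬_; Dec; yes; no)
open import Relation.Nullary.Decidable using (map′; _×-dec_; _⊎-dec_; ¬¬-excluded-middle)
open import Relation.Nullary.Negation using (DoubleNegation)

module _ {A : Set} {R : A → A → Set} where

  snoc : ∀ {a b c k} → Walk R a b k → R b c → Walk R a c (suc k)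
  snoc nil e = cons e nil
  snoc (cons e W) e′ = cons e (snoc W e′)

  _++ʷ_ : ∀ {a b c j k} → Walk R a b j → Walk R b c k → Walk R a c (j + k)
  nil ++ʷ W = W
  cons e V ++ʷ W = cons e (V ++ʷ W)

  reverse : (∀ {a b} → R a b → R b a) → ∀ {a b k} → Walk R a b k → Walk R b a k
  reverse R-sym nil = nil
  reverse R-sym (cons e W) = snoc (reverse R-sym W) (R-sym e)

  dist-refl : ∀ {a} → DistLe R 0 a a
  dist-refl = 0 , z≤n , nil

  dist-mono : ∀ {j k a b} → DistLe R j a b → j ≤ k → DistLe R k a b
  dist-mono (i , i≤j , W) j≤k = i , ≤-trans i≤j j≤k , W

  dist-cons : ∀ {k a b c} → R a b → DistLe R k b c → DistLe R (suc k) a c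
  dist-cons e (i , i≤k , W) = suc i , s≤s i≤k , cons e W

  dist-snoc : ∀ {k a b c} → DistLe R k a b → R b c → DistLe R (suc k) a c
  dist-snoc (i , i≤k , W) e = suc i , s≤s i≤k , snoc W e

  dist-trans : ∀ {j k a b c} → DistLe R j a b → DistLe R k b c → DistLe R (j + k) a c
  dist-trans (i , i≤j , V) (i′ , i′≤k , W) = i + i′ , +-mono-≤ i≤j i′≤k , V ++ʷ W

  -- Discrete intermediate value theorem.  Let Inv k c say that c may sit k
  -- steps before the end b of a walk; if Inv is preserved by steps and puts
  -- each such vertex in P or Q, then a walk from Q to a vertex outside Q has
  -- a step from Q into P.
  crossing : {P Q : A → Set} {b : A} (Inv : ℕ → A → Set) →
             (∀ {k c d} → Inv (suc k) c → R c d → Inv k d) →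
             (∀ {k c} → Inv k c → Walk R c b k → P c ⊎ Q c) →
             ∀ {a k} → Walk R a b k → Inv k a → Q a → ¬ Q b →
             ∃[ c ] ∃[ d ] (Q c × P d × R c d)
  crossing Inv step split nil inv qa ¬qb = ⊥-elim (¬qb qa)
  crossing Inv step split (cons e W) inv qa ¬qb with split (step inv e) W
  ... | inj₁ pd = _ , _ , qa , pd , e
  ... | inj₂ qd = crossing Inv step split W (step inv e) qd ¬qb

-- Double negation commutes with universal quantification over a finite type;
-- it lets us assume decidable adjacency when proving a decidable goal.
¬¬-∀Fin : ∀ m {P : Fin m → Set} →
          (∀ i → DoubleNegation (P i)) → DoubleNegation (∀ i → P i)
¬¬-∀Fin zero _ k = k (λ ())
¬¬-∀Fin (suc m) h k = h Fin.zero λ p₀ → ¬¬-∀Fin m (h ∘ Fin.suc) λ ps → k (∀-cons p₀ ps)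

Below : (ℕ → Set) → ℕ → Set
Below P k = ∀ j → j < k → ¬ P j

module _ {P : ℕ → Set} (P? : ∀ k → Dec (P k)) where

  firstBelow : ∀ m → Below P m ⊎ ∃[ k ] (k < m × P k × Below P k)
  firstBelow zero = inj₁ (λ j ())
  firstBelow (suc m) with firstBelow m
  ... | inj₂ (k , k<m , pk , none) = inj₂ (k , m<n⇒m<1+n k<m , pk , none)
  ... | inj₁ none with P? m
  ...   | yes pm = inj₂ (m , ≤-refl , pm , none)
  ...   | no ¬pm = inj₁ extended
    where
    extended : Below P (suc m)
    extended j j<1+m with m<1+n⇒m<n∨m≡n j<1+m
    ... | inj₁ j<m = none j j<m
    ... | inj₂ refl = ¬pm

  least : ∀ {m} → P m → ∃[ k ] (k ≤ m × P k × Below P k)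
  least {m} pm with firstBelow (suc m)
  ... | inj₁ none = ⊥-elim (none m ≤-refl pm)
  ... | inj₂ (k , k<1+m , pk , none) = k , ≤-pred k<1+m , pk , none

module _ {m : ℕ} {R : Fin m → Fin m → Set} (R? : ∀ a b → Dec (R a b)) where

  walk? : ∀ k a b → Dec (Walk R a b k)
  walk? zero a b = map′ (λ { refl → nil }) (λ { nil → refl }) (a Fin.≟ b)
  walk? (suc k) a b =
    map′ (λ (c , e , W) → cons e W) (λ { (cons e W) → _ , e , W })
         (any? λ c → R? a c ×-dec walk? k c b)

  dist? : ∀ k a b → Dec (DistLe R k a b)
  dist? k a b =
    map′ (λ (j , j<1+k , W) → j , ≤-pred j<1+k , W) (λ (j , j≤k , W) → j , s≤s j≤k , W)
         (anyUpTo? (λ j → walk? j a b) (suc k))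

∣⁅x⁆∪⁅y⁆∣≡2 : ∀ {m} {x y : Fin m} → ¬ x ≡ y → ∣ ⁅ x ⁆ ∪ ⁅ y ⁆ ∣ ≡ 2
∣⁅x⁆∪⁅y⁆∣≡2 {x = Fin.zero} {Fin.zero} x≢y = ⊥-elim (x≢y refl)
∣⁅x⁆∪⁅y⁆∣≡2 {x = Fin.zero} {Fin.suc y} _ =
  cong suc (trans (cong ∣_∣ (∪-identityˡ ⁅ y ⁆)) (∣⁅x⁆∣≡1 y))
∣⁅x⁆∪⁅y⁆∣≡2 {x = Fin.suc x} {Fin.zero} _ =
  cong suc (trans (cong ∣_∣ (∪-identityʳ ⁅ x ⁆)) (∣⁅x⁆∣≡1 x))
∣⁅x⁆∪⁅y⁆∣≡2 {x = Fin.suc x} {Fin.suc y} x≢y = ∣⁅x⁆∪⁅y⁆∣≡2 (x≢y ∘ cong Fin.suc)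

distinctElements : ∀ {m} (p : Subset m) t → t ≤ ∣ p ∣ →
                   Σ (Fin t → Fin m) λ f → (∀ i → f i ∈ p) × Injective _≡_ _≡_ f
distinctElements p zero _ = (λ ()) , (λ ()) , λ { {()} }
distinctElements (inside ∷ p) (suc t) (s≤s t≤∣p∣) with distinctElements p t t≤∣p∣
... | f , f∈p , f-inj = g , g∈p , g-inj
  where
  g : Fin (suc t) → Fin _
  g Fin.zero = Fin.zero
  g (Fin.suc i) = Fin.suc (f i)
  g∈p : ∀ i → g i ∈ (inside ∷ p)
  g∈p Fin.zero = here
  g∈p (Fin.suc i) = there (f∈p i)
  g-inj : Injective _≡_ _≡_ g
  g-inj {Fin.zero} {Fin.zero} _ = refl
  g-inj {Fin.suc i} {Fin.suc j} e = cong Fin.suc (f-inj (suc-injective e))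
distinctElements (outside ∷ p) t t≤∣p∣ with distinctElements p t t≤∣p∣
... | f , f∈p , f-inj = Fin.suc ∘ f , there ∘ f∈p , f-inj ∘ suc-injective

module Voronoi (G : Graph) (r : ℕ) (X : Subset (n G))
               (dist? : ∀ k a b → Dec (DistLe (Adj G) k a b)) where

  V : Set
  V = Fin (n G)

  D : ℕ → V → V → Set
  D k a b = DistLe (Adj G) k a b

  -- At a vertex v at distance k from x, centre x beats centre z: z is
  -- farther from v, or as far but of larger index.
  Beats : V → V → ℕ → V → Set
  Beats x z k v = (z Fin.< x → ¬ D k v z) × Below (λ j → D j v z) k

  Wins : V → ℕ → V → Set
  Wins x k v = k ≤ r × (∀ z → z ∈ X → ¬ z ≡ x → Beats x z k v)

  Cell : V → V → Set
  Cell x v = ∃[ k ] (Wins x k v × D k v x)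

  CellEdge : V → V → V → Set
  CellEdge x a b = Cell x a × Cell x b × Adj G a b

  cellEdge-sym : ∀ {x a b} → CellEdge x a b → CellEdge x b a
  cellEdge-sym (a∈x , b∈x , e) = b∈x , a∈x , sym G e

  cellGraph : V → Subgraph G
  cellGraph x = record { Vert = Cell x ; Edge = CellEdge x
                       ; edgeSym = cellEdge-sym
                       ; edge⊆ = λ (a∈x , b∈x , e) → e , a∈x , b∈x }

  beats-mono : ∀ {x z k m v} → Beats x z k v → m ≤ k → Beats x z m v
  beats-mono (tie , farther) m≤k =
    (λ z<x d → tie z<x (dist-mono d m≤k)) ,
    (λ j j<m d → farther j (≤-trans j<m m≤k) d)

  beats-step : ∀ {x z m v w} → Beats x z (suc m) v → Adj G v w → Beats x z m w
  beats-step (tie , farther) e =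
    (λ z<x d → tie z<x (dist-cons e d)) ,
    (λ j j<m d → farther (suc j) (s≤s j<m) (dist-cons e d))

  wins-mono : ∀ {x k m v} → Wins x k v → m ≤ k → Wins x m v
  wins-mono (k≤r , beats) m≤k =
    ≤-trans m≤k k≤r , λ z z∈X z≢x → beats-mono (beats z z∈X z≢x) m≤k

  wins-step : ∀ {x m v w} → Wins x (suc m) v → Adj G v w → Wins x m w
  wins-step (1+m≤r , beats) e =
    ≤-trans (n≤1+n _) 1+m≤r , λ z z∈X z≢x → beats-step (beats z z∈X z≢x) e

  wins⇒cell : ∀ {x m v} → Wins x m v → Walk (Adj G) v x m → Cell x v
  wins⇒cell wins W = _ , wins , (_ , ≤-refl , W)

  walkInCell : ∀ {x m v} → Wins x m v → Walk (Adj G) v x m → Walk (CellEdge x) v x m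
  walkInCell wins nil = nil
  walkInCell wins (cons e W) =
    cons (wins⇒cell wins (cons e W) , wins⇒cell (wins-step wins e) W , e)
         (walkInCell (wins-step wins e) W)

  centre∈cell : ∀ x → Cell x x
  centre∈cell x = 0 , (z≤n , λ z _ z≢x → (λ { _ (_ , z≤n , nil) → z≢x refl }) , λ j ()) , dist-refl

  centreReaches : ∀ {x v} → Cell x v → DistLe (CellEdge x) r x v
  centreReaches (k , wins , (m , m≤k , W)) =
    m , ≤-trans m≤k (proj₁ wins) , reverse cellEdge-sym (walkInCell (wins-mono wins m≤k) W)

  -- Cells of distinct centres are disjoint: compare the two distances, and
  -- on a tie the two indices.
  cells-disjoint : ∀ {x y} → x ∈ X → y ∈ X → ¬ x ≡ y → ∀ v → Cell x v → ¬ Cell y v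
  cells-disjoint {x} {y} x∈X y∈X x≢y v (k , (_ , x-beats) , dx) (l , (_ , y-beats) , dy)
    with <-cmp x y | ℕₚ.<-cmp k l
  ... | _ | tri< k<l _ _ = proj₂ (y-beats x x∈X x≢y) k k<l dx
  ... | _ | tri> _ _ l<k = proj₂ (x-beats y y∈X (x≢y ∘ ≡-sym)) l l<k dy
  ... | tri< x<y _ _ | tri≈ _ refl _ = proj₁ (y-beats x x∈X x≢y) x<y dx
  ... | tri≈ _ x≡y _ | tri≈ _ refl _ = x≢y x≡y
  ... | tri> _ _ y<x | tri≈ _ refl _ = proj₁ (x-beats y y∈X (x≢y ∘ ≡-sym)) y<x dy

  Prefers : V → V → ℕ → V → Set
  Prefers x y k w = D k w x × Beats x y k w

  -- At the least distance k at which w sees x or y, one of the two is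
  -- preferred: the one seen at k, the one of smaller index if both are.
  prefer-smaller : ∀ {x y k w} → x Fin.< y → D k w x ⊎ D k w y →
                   Below (λ j → D j w x) k → Below (λ j → D j w y) k →
                   Prefers x y k w ⊎ Prefers y x k w
  prefer-smaller {x} {y} {k} {w} x<y seen x-far y-far with dist? k w x
  ... | yes dx = inj₁ (dx , (λ y<x → ⊥-elim (<-asym x<y y<x)) , y-far)
  ... | no ¬dx = inj₂ ([ ⊥-elim ∘ ¬dx , (λ dy → dy) ] seen , (λ _ → ¬dx) , x-far)

  prefer : ∀ {x y k w} → ¬ x ≡ y → D k w x ⊎ D k w y →
           Below (λ j → D j w x) k → Below (λ j → D j w y) k →
           Prefers x y k w ⊎ Prefers y x k w
  prefer {x} {y} x≢y seen x-far y-far with <-cmp x y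
  ... | tri< x<y _ _ = prefer-smaller x<y seen x-far y-far
  ... | tri≈ _ x≡y _ = ⊥-elim (x≢y x≡y)
  ... | tri> _ _ y<x = swap (prefer-smaller y<x (swap seen) y-far x-far)

  preferred∈cell : ∀ {x y k m w} → Prefers x y k w → k ≤ m → m ≤ r →
                   (∀ z → z ∈ X → ¬ z ≡ x → ¬ z ≡ y → ¬ D m w z) → Cell x w
  preferred∈cell {x} {y} {k} {m} {w} (dx , beats-y) k≤m m≤r no-rival =
    k , (≤-trans k≤m m≤r , beats) , dx
    where
    beats : ∀ z → z ∈ X → ¬ z ≡ x → Beats x z k w
    beats z z∈X z≢x with z Fin.≟ y
    ... | yes refl = beats-y
    ... | no z≢y = (λ _ dz → no-rival z z∈X z≢x z≢y (dist-mono dz k≤m)) ,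
                   (λ j j<k dz → no-rival z z∈X z≢x z≢y (dist-mono dz (≤-trans (<⇒≤ j<k) k≤m)))

  cellOfTwo : ∀ {x y m w} → ¬ x ≡ y → m ≤ r → D m w x →
              (∀ z → z ∈ X → ¬ z ≡ x → ¬ z ≡ y → ¬ D m w z) → Cell x w ⊎ Cell y w
  cellOfTwo {x} {y} {m} {w} x≢y m≤r dx no-rival
    with least (λ k → dist? k w x ⊎-dec dist? k w y) (inj₁ dx)
  ... | k , k≤m , seen , none =
    Sum.map (λ pref → preferred∈cell pref k≤m m≤r no-rival)
            (λ pref → preferred∈cell pref k≤m m≤r (λ z z∈X z≢y z≢x → no-rival z z∈X z≢x z≢y))
            (prefer x≢y seen (λ j j<k → none j j<k ∘ inj₁) (λ j j<k → none j j<k ∘ inj₂))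

  Separates : V → V → V → Set
  Separates u x y = ∀ z → z ∈ X → D r u z → z ≡ x ⊎ z ≡ y

  OnRoute : V → ℕ → V → Set
  OnRoute u k w = ∃[ s ] (D s u w × s + k ≤ r)

  route-step : ∀ {u k w w′} → OnRoute u (suc k) w → Adj G w w′ → OnRoute u k w′
  route-step {k = k} (s , ds , s+1+k≤r) e = suc s , dist-snoc ds e , subst (_≤ r) (+-suc s k) s+1+k≤r

  route∈cells : ∀ {u x y k w} → ¬ x ≡ y → Separates u x y → OnRoute u k w →
                Walk (Adj G) w x k → Cell x w ⊎ Cell y w
  route∈cells {k = k} x≢y sep (s , ds , s+k≤r) W =
    cellOfTwo x≢y (≤-trans (m≤n+m k s) s+k≤r) (k , ≤-refl , W)
      λ z z∈X z≢x z≢y dz → [ z≢x , z≢y ] (sep z z∈X (dist-mono (dist-trans ds dz) s+k≤r))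

  Adjacent : V → V → Set
  Adjacent x y = ∃[ a ] ∃[ b ] (Cell x a × Cell y b × Adj G a b)

  adjacent-sym : ∀ {x y} → Adjacent x y → Adjacent y x
  adjacent-sym (a , b , a∈x , b∈y , e) = b , a , b∈y , a∈x , sym G e

  crossTowards : ∀ {u x y} → x ∈ X → y ∈ X → ¬ x ≡ y → Separates u x y →
                 Cell y u → D r u x → Adjacent y x
  crossTowards {x = x} x∈X y∈X x≢y sep u∈y (m , m≤r , W) =
    crossing (OnRoute _) route-step (route∈cells x≢y sep) W (0 , dist-refl , m≤r) u∈y
             (cells-disjoint x∈X y∈X x≢y x (centre∈cell x))

  separated⇒adjacent : ∀ {u x y} → x ∈ X → y ∈ X → ¬ x ≡ y → Separates u x y →
                       D r u x → D r u y → Adjacent x y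
  separated⇒adjacent x∈X y∈X x≢y sep dx dy
    with cellOfTwo x≢y ≤-refl dx (λ z z∈X z≢x z≢y → [ z≢x , z≢y ] ∘ sep z z∈X)
  ... | inj₁ u∈x = crossTowards y∈X x∈X (x≢y ∘ ≡-sym) (λ z z∈X → swap ∘ sep z z∈X) u∈x dy
  ... | inj₂ u∈y = adjacent-sym (crossTowards x∈X y∈X x≢y sep u∈y dx)

  shattered⇒separated : TwoShattered G r X → ∀ {x y} → x ∈ X → y ∈ X → ¬ x ≡ y →
                        ∃[ u ] (Separates u x y × D r u x × D r u y)
  shattered⇒separated shattered {x} {y} x∈X y∈X x≢y with shattered (⁅ x ⁆ ∪ ⁅ y ⁆) pair⊆X (∣⁅x⁆∪⁅y⁆∣≡2 x≢y)
    where
    pair⊆X : ⁅ x ⁆ ∪ ⁅ y ⁆ ⊆ X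
    pair⊆X z∈pair with x∈p∪q⁻ ⁅ x ⁆ ⁅ y ⁆ z∈pair
    ... | inj₁ z∈⁅x⁆ = subst (_∈ X) (≡-sym (x∈⁅y⁆⇒x≡y x z∈⁅x⁆)) x∈X
    ... | inj₂ z∈⁅y⁆ = subst (_∈ X) (≡-sym (x∈⁅y⁆⇒x≡y y z∈⁅y⁆)) y∈X
  ... | u , ball∩X⇔pair = u , sep , inBall (inj₁ (x∈⁅x⁆ x)) , inBall (inj₂ (x∈⁅x⁆ y))
    where
    inBall : ∀ {z} → z ∈ ⁅ x ⁆ ⊎ z ∈ ⁅ y ⁆ → D r u z
    inBall z∈pair = proj₂ (Equivalence.from (ball∩X⇔pair _) (x∈p∪q⁺ z∈pair))
    sep : Separates u x y
    sep z z∈X dz = Sum.map (x∈⁅y⁆⇒x≡y x) (x∈⁅y⁆⇒x≡y y)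
                           (x∈p∪q⁻ ⁅ x ⁆ ⁅ y ⁆ (Equivalence.to (ball∩X⇔pair z) (z∈X , dz)))

  voronoiMinor : TwoShattered G r X → ∀ t → t ≤ ∣ X ∣ → KtDepthMinor r t G
  voronoiMinor shattered t t≤∣X∣ with distinctElements X t t≤∣X∣
  ... | c , c∈X , c-inj =
    (λ i → cellGraph (c i)) , connected , radius , disjoint , adjacent
    where
    connected : ∀ i → Connected (cellGraph (c i))
    connected i a b a∈c b∈c with centreReaches a∈c | centreReaches b∈c
    ... | _ , _ , Wa | _ , _ , Wb = _ , reverse cellEdge-sym Wa ++ʷ Wb
    radius : ∀ i → RadiusLe r (cellGraph (c i))
    radius i = c i , centre∈cell (c i) , λ v → centreReaches
    disjoint : ∀ i j → ¬ i ≡ j → ∀ v → Cell (c i) v → ¬ Cell (c j) v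
    disjoint i j i≢j = cells-disjoint (c∈X i) (c∈X j) (i≢j ∘ c-inj)
    adjacent : ∀ i j → ¬ i ≡ j → Adjacent (c i) (c j)
    adjacent i j i≢j with shattered⇒separated shattered (c∈X i) (c∈X j) (i≢j ∘ c-inj)
    ... | u , sep , dx , dy = separated⇒adjacent (c∈X i) (c∈X j) (i≢j ∘ c-inj) sep dx dy

theorem1p2 : (r t : ℕ) → 1 ≤ r → 1 ≤ t → (G : Graph) →
    ¬ KtDepthMinor r t G → TwoVCDimBallsLe G r (t ∸ 1)
theorem1p2 r t _ 1≤t G no-minor X shattered with ∣ X ∣ ≤? t ∸ 1
... | yes small = small
... | no ¬small = ⊥-elim (
  ¬¬-∀Fin (n G) (λ a → ¬¬-∀Fin (n G) (λ b → ¬¬-excluded-middle)) λ adj? →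
    no-minor (Voronoi.voronoiMinor G r X (dist? adj?) shattered t t≤∣X∣))
  where
  t≤∣X∣ : t ≤ ∣ X ∣
  t≤∣X∣ = subst (_≤ ∣ X ∣) (m+[n∸m]≡n 1≤t) (≰⇒> ¬small)
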